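{- Let $\mathcal{G}$ and $\mathcal{H}$ be two graph classes, where $\mathcal{G}$ contains $K_2$. Then: (1) If $\mathcal{G}$ is union-closed, then $c^{\mathcal{G}}_{\mathrm g}(H)=c^{\mathcal{G}}_{\mathrm u}(H)$ for all graphs $H\in\mathcal{H}$; in particular $\mathcal{H}$ is $(c^{\mathcal{G}}_{\mathrm g},c^{\mathcal{G}}_{\mathrm u})$-bounded. (2) If $\mathcal{H}$ is monotone, then $\mathcal{H}$ is $(c^{\mathcal{G}}_{\mathrm g},c^{\mathcal{G}}_{\mathrm u})$-bounded if and only if $\max\{c^{\mathcal{G}}_{\mathrm g}(J) : J\in\overline{\mathcal{G}}\cap\mathcal{H}\}<\infty$, i.e. there is a constant $C$ with $c^{\mathcal{G}}_{\mathrm g}(J)\le C$ for all $J\in\overline{\mathcal{G}}\cap\mathcal{H}$.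
   Context: All graphs are finite and simple. For graphs $G,H$, a homomorphism $\varphi\colon G\to H$ is a map $V(G)\to V(H)$ with $\varphi(u)\varphi(v)\in E(H)$ whenever $uv\in E(G)$. $\dot\cup$ denotes vertex-disjoint union. For a graph class $\mathcal{G}$ (guest class) and a graph $H$ (host), a $\mathcal{G}$-cover of $H$ is an edge-surjective homomorphism $\varphi\colon G_1\dot\cup\cdots\dot\cup G_t\to H$ with all $G_i\in\mathcal{G}$; it is called $t$-global, it is injective if each restriction $\varphi|_{G_i}$ is injective, and it is $s$-local if $|\varphi^{ -1}(v)|\le s$ for all $v\in V(H)$. $\overline{\mathcal{G}}$ denotes the class of all vertex-disjoint unions of graphs in $\mathcal{G}$; $\mathcal{G}$ is union-closed if $\overline{\mathcal{G}}=\mathcal{G}$. Covering numbers: $c^{\mathcal{G}}_{\mathrm g}(H)$ is the least $t$ such that $H$ has a $t$-global injective $\mathcal{G}$-cover; $c^{\mathcal{G}}_{\mathrm u}(H)$ is the least $t$ such that $H$ has a $t$-global injective $\overline{\mathcal{G}}$-cover; $c^{\mathcal{G}}_{\mathrm l}(H)$ is the least $s$ such that $H$ has an $s$-local injective $\mathcal{G}$-cover; $c^{\mathcal{G}}_{\mathrm f}(H)$ is the least $s$ such that $H$ has an $s$-local (not necessarily injective) $\mathcal{G}$-cover. For $\mathrm x,\mathrm y\in\{\mathrm g,\mathrm u,\mathrm l,\mathrm f\}$, a class $\mathcal{H}$ is $(c^{\mathcal{G}}_{\mathrm x},c^{\mathcal{G}}_{\mathrm y})$-bounded if there is a function $f\colon\mathbb{N}\to\mathbb{R}_{\ge0}$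 with $c^{\mathcal{G}}_{\mathrm y}(H)\le c^{\mathcal{G}}_{\mathrm x}(H)\le f(c^{\mathcal{G}}_{\mathrm y}(H))$ for all $H\in\mathcal{H}$. A class is monotone if it is closed under taking subgraphs. -}

module Defs where

open import Data.Nat using (ℕ; zero; suc; _+_; _≤_)
open import Data.Fin using (Fin; zero; suc; splitAt)
open import Data.Bool using (Bool; true; false)
open import Data.Sum using (_⊎_; inj₁; inj₂)
open import Data.Product using (Σ; ∃; ∃-syntax; _×_; _,_)
open import Data.List using (List; []; _∷_)
open import Data.List.Relation.Unary.All using (All)
open import Relation.Binary.PropositionalEquality using (_≡_; refl)
open import Function.Definitions using (Injective)
open import Function.Bundles using (_⇔_)

record Graph : Set where
  field
    n      : ℕ
    adj    : Fin n → Fin n → Bool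
    sym    : ∀ u v → adj u v ≡ adj v u
    irrefl : ∀ u → adj u u ≡ false

open Graph public

V : Graph → Set
V G = Fin (n G)

E : (G : Graph) → V G → V G → Set
E G u v = adj G u v ≡ true

record _≅_ (G H : Graph) : Set where
  field
    to       : V G → V H
    from     : V H → V G
    to-from  : ∀ x → to (from x) ≡ x
    from-to  : ∀ u → from (to u) ≡ u
    preserve : ∀ u v → adj G u v ≡ adj H (to u) (to v)

record GraphClass : Set₁ where
  field
    Mem    : Graph → Set
    closed : ∀ {G H} → G ≅ H → Mem G → Mem H

open GraphClass public

_∈_ : Graph → GraphClass → Set
G ∈ 𝒞 = Mem 𝒞 G

K₂ : Graph
K₂ = record { n = 2 ; adj = a ; sym = s ; irrefl = i }
  where
  a : Fin 2 → Fin 2 → Bool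
  a zero zero = false
  a zero (suc zero) = true
  a (suc zero) zero = true
  a (suc zero) (suc zero) = false
  s : ∀ u v → a u v ≡ a v u
  s zero zero = refl
  s zero (suc zero) = refl
  s (suc zero) zero = refl
  s (suc zero) (suc zero) = refl
  i : ∀ u → a u u ≡ false
  i zero = refl
  i (suc zero) = refl

private
  adj⊎ : ∀ {a b} → (Fin a → Fin a → Bool) → (Fin b → Fin b → Bool)
       → Fin a ⊎ Fin b → Fin a ⊎ Fin b → Bool
  adj⊎ A B (inj₁ x) (inj₁ y) = A x y
  adj⊎ A B (inj₂ x) (inj₂ y) = B x y
  adj⊎ A B (inj₁ x) (inj₂ y) = false
  adj⊎ A B (inj₂ x) (inj₁ y) = false

  adj⊎-sym : ∀ {a b} (A : Fin a → Fin a → Bool) (B : Fin b → Fin b → Bool)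
           → (∀ x y → A x y ≡ A y x) → (∀ x y → B x y ≡ B y x)
           → ∀ p q → adj⊎ A B p q ≡ adj⊎ A B q p
  adj⊎-sym A B sA sB (inj₁ x) (inj₁ y) = sA x y
  adj⊎-sym A B sA sB (inj₂ x) (inj₂ y) = sB x y
  adj⊎-sym A B sA sB (inj₁ x) (inj₂ y) = refl
  adj⊎-sym A B sA sB (inj₂ x) (inj₁ y) = refl

  adj⊎-irr : ∀ {a b} (A : Fin a → Fin a → Bool) (B : Fin b → Fin b → Bool)
           → (∀ x → A x x ≡ false) → (∀ x → B x x ≡ false)
           → ∀ p → adj⊎ A B p p ≡ false
  adj⊎-irr A B iA iB (inj₁ x) = iA x
  adj⊎-irr A B iA iB (inj₂ x) = iB x

_⊕_ : Graph → Graph → Graph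
G ⊕ H = record
  { n      = n G + n H
  ; adj    = λ u v → adj⊎ (adj G) (adj H) (splitAt (n G) u) (splitAt (n G) v)
  ; sym    = λ u v → adj⊎-sym (adj G) (adj H) (sym G) (sym H) (splitAt (n G) u) (splitAt (n G) v)
  ; irrefl = λ u → adj⊎-irr (adj G) (adj H) (irrefl G) (irrefl H) (splitAt (n G) u)
  }

⋃ : Graph → List Graph → Graph
⋃ G []       = G
⋃ G (H ∷ Hs) = G ⊕ ⋃ H Hs

-- 𝒢̄ : all vertex-disjoint unions of (at least one) graphs in 𝒢
UnionMem : GraphClass → Graph → Set
UnionMem 𝒢 J = Σ Graph λ G → Σ (List Graph) λ Gs →
  G ∈ 𝒢 × All (λ G' → G' ∈ 𝒢) Gs × (J ≅ ⋃ G Gs)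

UnionClosed : GraphClass → Set
UnionClosed 𝒢 = ∀ J → UnionMem 𝒢 J → J ∈ 𝒢

-- monotone = closed under taking subgraphs
-- (G' is (isomorphic to) a subgraph of G iff there is an injective homomorphism G' → G)
IsSubgraph : Graph → Graph → Set
IsSubgraph G' G = Σ (V G' → V G) λ f →
  Injective _≡_ _≡_ f × (∀ u v → E G' u v → E G (f u) (f v))

Monotone : GraphClass → Set
Monotone ℋ = ∀ G G' → G ∈ ℋ → IsSubgraph G' G → G' ∈ ℋ

-- Covers.  A homomorphism φ : G₁ ∪̇ ⋯ ∪̇ Gₜ → H is given by its
-- restrictions φᵢ : Gᵢ → H.

record Cover (P : Graph → Set) (H : Graph) : Set where
  field
    t      : ℕ
    guest  : Fin t → Graph
    inP    : ∀ i → P (guest i)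
    φ      : (i : Fin t) → V (guest i) → V H
    hom    : ∀ i u v → E (guest i) u v → E H (φ i u) (φ i v)
    surj   : ∀ x y → E H x y →
             Σ (Fin t) λ i → Σ (V (guest i)) λ u → Σ (V (guest i)) λ v →
               E (guest i) u v × φ i u ≡ x × φ i v ≡ y

open Cover public

InjectiveCover : ∀ {P H} → Cover P H → Set
InjectiveCover c = ∀ i → Injective _≡_ _≡_ (φ c i)

HasGlobalInj : (Graph → Set) → Graph → ℕ → Set
HasGlobalInj P H k = Σ (Cover P H) λ c → t c ≡ k × InjectiveCover c

IsLeast : (ℕ → Set) → ℕ → Set
IsLeast Q m = Q m × (∀ k → Q k → m ≤ k)

c-g : GraphClass → Graph → ℕ → Set
c-g 𝒢 H m = IsLeast (HasGlobalInj (Mem 𝒢) H) m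

c-u : GraphClass → Graph → ℕ → Set
c-u 𝒢 H m = IsLeast (HasGlobalInj (UnionMem 𝒢) H) m

Bounded : GraphClass → (Graph → ℕ → Set) → (Graph → ℕ → Set) → Set
Bounded ℋ cx cy = Σ (ℕ → ℕ) λ f → ∀ H → H ∈ ℋ → ∀ a b → cx H a → cy H b →
  (b ≤ a × a ≤ f b)

{-# OPTIONS --safe #-}
module Submission where

open import Defs
open import Data.Nat using (ℕ; zero; suc; _+_; _*_; _≤_; _<_; z≤n; s≤s; _≤?_)
open import Data.Nat.Properties
  using (≤-trans; ≤-antisym; ≰⇒>; +-mono-≤; m≤m+n; m≤n+m; module ≤-Reasoning)
open import Data.Nat.Induction using (<-rec)
open import Data.Fin using (Fin; zero; suc)
open import Data.Bool using (true) renaming (_≟_ to _≟ᵇ_)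
open import Data.Product using (Σ; ∃; _×_; _,_; proj₁; proj₂)
open import Data.List using (List; []; _∷_; _++_; length; lookup; tabulate; concat; map)
open import Data.List.Properties using (length-++; length-map; length-tabulate)
open import Data.List.Relation.Unary.All using ([])
open import Data.List.Relation.Unary.Any using (Any; here; index)
import Data.List.Relation.Unary.Any as Any
open import Data.List.Relation.Unary.Any.Properties using (lookup-index; tabulate⁺; concat⁺; map⁺)
open import Function using (_∘_; id)
open import Function.Bundles using (_⇔_; mk⇔)
open import Relation.Nullary using (¬_; yes; no; contradiction; ¬¬-map)
open import Relation.Nullary.Decidable using (decidable-stable)
open import Relation.Binary.PropositionalEquality
  using (_≡_; _≢_; refl; trans) renaming (sym to ≡-sym)

-- c_u ≤ c_g because every 𝒢-cover is a 𝒢̄-cover, with equality when 𝒢 is union-closed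
-- since then 𝒢̄ = 𝒢.  For (2), every J ∈ 𝒢̄ covers itself, so c_u(J) ≤ 1 and a bounding
-- function f gives c_g(J) ≤ f 0 + f 1 on 𝒢̄ ∩ ℋ.  Conversely, if c_g ≤ C on 𝒢̄ ∩ ℋ, take
-- an optimal injective 𝒢̄-cover of H ∈ ℋ by b guests: each guest embeds in H, so lies in
-- ℋ by monotonicity and has an injective 𝒢-cover by at most C graphs; composing these
-- covers with the embeddings gives c_g(H) ≤ b·C.  The hypothesis K₂ ∈ 𝒢 only serves to
-- cover every graph edge by edge, so that c_g is defined at all.
--
-- Since injective coverability is undecidable in general, the least elements defining
-- c_g and c_u are only available under double negation; all conclusions drawn from them
-- are inequalities on ℕ, which are decidable and hence ¬¬-stable.

¬¬-∃-least : ∀ {Q : ℕ → Set} k → Q k → ¬ ¬ ∃ (IsLeast Q)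
¬¬-∃-least {Q} = <-rec _ step
  where
  step : ∀ k → (∀ {j} → j < k → Q j → ¬ ¬ ∃ (IsLeast Q)) → Q k → ¬ ¬ ∃ (IsLeast Q)
  step k below qk no-least = no-least (k , qk , λ j qj →
    decidable-stable (k ≤? j) λ k≰j → below (≰⇒> k≰j) qj no-least)

least≤⇒¬¬∃≤ : ∀ {Q : ℕ → Set} {C} → ∃ Q → (∀ m → IsLeast Q m → m ≤ C) → ¬ ¬ ∃ λ m → m ≤ C × Q m
least≤⇒¬¬∃≤ (k , qk) bound =
  ¬¬-map (λ (m , m-least) → m , bound m m-least , proj₁ m-least) (¬¬-∃-least k qk)

¬¬-∀-Fin : ∀ {n} {P : Fin n → Set} → (∀ i → ¬ ¬ P i) → ¬ ¬ (∀ i → P i)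
¬¬-∀-Fin {zero}  _   k = k λ ()
¬¬-∀-Fin {suc n} ¬¬P k = ¬¬P zero λ p₀ → ¬¬-∀-Fin (¬¬P ∘ suc) λ ps →
  k λ { zero → p₀ ; (suc i) → ps i }

length-concat-tabulate-≤ : ∀ {A : Set} {t C} (xss : Fin t → List A) →
  (∀ i → length (xss i) ≤ C) → length (concat (tabulate xss)) ≤ t * C
length-concat-tabulate-≤ {t = zero}      _   _  = z≤n
length-concat-tabulate-≤ {t = suc t} {C} xss ≤C = begin
  length (xss zero ++ rest)       ≡⟨ length-++ (xss zero) ⟩
  length (xss zero) + length rest ≤⟨ +-mono-≤ (≤C zero) rest-≤ ⟩
  C + t * C                       ∎
  where
  open ≤-Reasoning
  rest = concat (tabulate (xss ∘ suc))
  rest-≤ = length-concat-tabulate-≤ (xss ∘ suc) (≤C ∘ suc)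

-- Injective covers are handled as lists of guests, so that refining a cover is a concatenation.
record Guest (P : Graph → Set) (H : Graph) : Set where
  field
    graph     : Graph
    graph∈P   : P graph
    embed     : V graph → V H
    embed-hom : ∀ u v → E graph u v → E H (embed u) (embed v)
    embed-inj : ∀ {u v} → embed u ≡ embed v → u ≡ v

module _ {P : Graph → Set} {H : Graph} where

  Covers : Guest P H → V H → V H → Set
  Covers g x y = Σ (V graph) λ u → Σ (V graph) λ v → E graph u v × embed u ≡ x × embed v ≡ y
    where open Guest g

  IsCovering : List (Guest P H) → Set
  IsCovering gs = ∀ x y → E H x y → Any (λ g → Covers g x y) gs

  fromGuests : (gs : List (Guest P H)) → IsCovering gs → HasGlobalInj P H (length gs)
  fromGuests gs covering = cover , refl , Guest.embed-inj ∘ lookup gs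
    where
    cover : Cover P H
    cover = record
      { t     = length gs
      ; guest = Guest.graph ∘ lookup gs
      ; inP   = Guest.graph∈P ∘ lookup gs
      ; φ     = Guest.embed ∘ lookup gs
      ; hom   = Guest.embed-hom ∘ lookup gs
      ; surj  = λ x y xy → index (covering x y xy) , lookup-index (covering x y xy)
      }

  guest-at : (c : Cover P H) → InjectiveCover c → Fin (t c) → Guest P H
  guest-at c inj i = record
    { graph = guest c i ; graph∈P = inP c i
    ; embed = φ c i ; embed-hom = hom c i ; embed-inj = inj i }

  guests : ∀ {k} → HasGlobalInj P H k → List (Guest P H)
  guests (c , _ , inj) = tabulate (guest-at c inj)

  length-guests : ∀ {k} (cover : HasGlobalInj P H k) → length (guests cover) ≡ k
  length-guests (c , refl , inj) = length-tabulate (guest-at c inj)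

  guests-isCovering : ∀ {k} (cover : HasGlobalInj P H k) → IsCovering (guests cover)
  guests-isCovering (c , _ , _) x y xy = let (i , covers) = surj c x y xy in tabulate⁺ i covers

_∘ᵍ_ : ∀ {P Q H} (g : Guest P H) → Guest Q (Guest.graph g) → Guest Q H
g ∘ᵍ h = record
  { graph     = graph h
  ; graph∈P   = graph∈P h
  ; embed     = embed g ∘ embed h
  ; embed-hom = λ u v uv → embed-hom g _ _ (embed-hom h u v uv)
  ; embed-inj = embed-inj h ∘ embed-inj g
  }
  where open Guest

∘ᵍ-covers : ∀ {P Q H} (g : Guest P H) {u v} {h : Guest Q (Guest.graph g)} →
  Covers h u v → Covers (g ∘ᵍ h) (Guest.embed g u) (Guest.embed g v)
∘ᵍ-covers g (u′ , v′ , u′v′ , refl , refl) = u′ , v′ , u′v′ , refl , refl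

map-∘ᵍ-covers : ∀ {P Q H} (g : Guest P H) {u v} {hs : List (Guest Q (Guest.graph g))} →
  Any (λ h → Covers h u v) hs →
  Any (λ h → Covers h (Guest.embed g u) (Guest.embed g v)) (map (g ∘ᵍ_) hs)
map-∘ᵍ-covers g {u} {v} covers = map⁺ (Any.map (λ {h} → ∘ᵍ-covers g {u} {v} {h}) covers)

HasGlobalInj≤ : (Graph → Set) → Graph → ℕ → Set
HasGlobalInj≤ P H C = Σ ℕ λ k → k ≤ C × HasGlobalInj P H k

refine-cover : ∀ {P Q H C} (c : Cover P H) → InjectiveCover c →
  (∀ i → HasGlobalInj≤ Q (guest c i) C) → HasGlobalInj≤ Q H (t c * C)
refine-cover {Q = Q} {H} {C} c inj guest-covers =
  length refined , length-concat-tabulate-≤ lifted lifted-≤ , fromGuests refined covering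
  where
  inner : ∀ i → List (Guest Q (guest c i))
  inner i = guests (proj₂ (proj₂ (guest-covers i)))

  lifted : Fin (t c) → List (Guest Q H)
  lifted i = map (guest-at c inj i ∘ᵍ_) (inner i)

  lifted-≤ : ∀ i → length (lifted i) ≤ C
  lifted-≤ i = begin
    length (lifted i)      ≡⟨ length-map (guest-at c inj i ∘ᵍ_) (inner i) ⟩
    length (inner i)       ≡⟨ length-guests (proj₂ (proj₂ (guest-covers i))) ⟩
    proj₁ (guest-covers i) ≤⟨ proj₁ (proj₂ (guest-covers i)) ⟩
    C                      ∎
    where open ≤-Reasoning

  refined : List (Guest Q H)
  refined = concat (tabulate lifted)

  covering : IsCovering refined
  covering x y xy with surj c x y xy
  ... | i , u , v , uv , refl , refl = concat⁺ (tabulate⁺ i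
    (map-∘ᵍ-covers (guest-at c inj i) (guests-isCovering (proj₂ (proj₂ (guest-covers i))) u v uv)))

module _ {P : Graph → Set} (K₂∈P : P K₂) {H : Graph} where

  K₂-guest : ∀ {x y} → E H x y → Guest P H
  K₂-guest {x} {y} xy = record
    { graph = K₂ ; graph∈P = K₂∈P ; embed = edge ; embed-hom = edge-hom ; embed-inj = edge-inj }
    where
    edge : V K₂ → V H
    edge zero       = x
    edge (suc zero) = y

    edge-hom : ∀ u v → E K₂ u v → E H (edge u) (edge v)
    edge-hom zero       zero       ()
    edge-hom zero       (suc zero) _ = xy
    edge-hom (suc zero) zero       _ = trans (sym H y x) xy
    edge-hom (suc zero) (suc zero) ()

    x≢y : x ≢ y
    x≢y refl = contradiction (trans (≡-sym xy) (irrefl H x)) λ ()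

    edge-inj : ∀ {u v} → edge u ≡ edge v → u ≡ v
    edge-inj {zero}     {zero}     _   = refl
    edge-inj {zero}     {suc zero} x≡y = contradiction x≡y x≢y
    edge-inj {suc zero} {zero}     y≡x = contradiction (≡-sym y≡x) x≢y
    edge-inj {suc zero} {suc zero} _   = refl

  edge-guests : V H → V H → List (Guest P H)
  edge-guests x y with adj H x y ≟ᵇ true
  ... | yes xy = K₂-guest xy ∷ []
  ... | no  _  = []

  edge-guests-covers : ∀ {x y} → E H x y → Any (λ g → Covers g x y) (edge-guests x y)
  edge-guests-covers {x} {y} xy with adj H x y ≟ᵇ true
  ... | yes _   = here (zero , suc zero , refl , refl , refl)
  ... | no  ¬xy = contradiction xy ¬xy

  edge-cover : ∃ (HasGlobalInj P H)
  edge-cover = _ , fromGuests all-edge-guests covering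
    where
    all-edge-guests : List (Guest P H)
    all-edge-guests = concat (tabulate λ x → concat (tabulate (edge-guests x)))

    covering : IsCovering all-edge-guests
    covering x y xy = concat⁺ (tabulate⁺ x (concat⁺ (tabulate⁺ y (edge-guests-covers xy))))

HasGlobalInj-map : ∀ {P Q : Graph → Set} {H k} →
  (∀ {G} → P G → Q G) → HasGlobalInj P H k → HasGlobalInj Q H k
HasGlobalInj-map P⇒Q (c , tc , inj) = c′ , tc , inj
  where
  c′ : Cover _ _
  c′ = record
    { t = t c ; guest = guest c ; inP = P⇒Q ∘ inP c ; φ = φ c ; hom = hom c ; surj = surj c }

HasGlobalInj-self : ∀ {P : Graph → Set} {H} → P H → HasGlobalInj P H 1
HasGlobalInj-self {H = H} H∈P = c , refl , λ _ → id
  where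
  c : Cover _ H
  c = record
    { t = 1 ; guest = λ _ → H ; inP = λ _ → H∈P ; φ = λ _ → id ; hom = λ _ _ _ → id
    ; surj = λ x y xy → zero , x , y , xy , refl , refl }

∈⇒UnionMem : ∀ 𝒢 {G} → G ∈ 𝒢 → UnionMem 𝒢 G
∈⇒UnionMem 𝒢 {G} G∈𝒢 = G , [] , G∈𝒢 , [] , ≅-refl
  where
  ≅-refl : G ≅ G
  ≅-refl = record
    { to = id ; from = id ; to-from = λ _ → refl ; from-to = λ _ → refl ; preserve = λ _ _ → refl }

c-u≤c-g : ∀ 𝒢 {H a b} → c-g 𝒢 H a → c-u 𝒢 H b → b ≤ a
c-u≤c-g 𝒢 (cover , _) (_ , b-least) = b-least _ (HasGlobalInj-map (∈⇒UnionMem 𝒢) cover)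

c-g≤c-u : ∀ 𝒢 {H a b} → UnionClosed 𝒢 → c-g 𝒢 H a → c-u 𝒢 H b → a ≤ b
c-g≤c-u 𝒢 closed (_ , a-least) (cover , _) = a-least _ (HasGlobalInj-map (closed _) cover)

c-g≡c-u : ∀ 𝒢 {H a b} → UnionClosed 𝒢 → c-g 𝒢 H a → c-u 𝒢 H b → a ≡ b
c-g≡c-u 𝒢 closed a-least b-least =
  ≤-antisym (c-g≤c-u 𝒢 closed a-least b-least) (c-u≤c-g 𝒢 a-least b-least)

union-closed⇒bounded : ∀ 𝒢 ℋ → UnionClosed 𝒢 → Bounded ℋ (c-g 𝒢) (c-u 𝒢)
union-closed⇒bounded 𝒢 ℋ closed =
  id , λ _ _ _ _ a-least b-least → c-u≤c-g 𝒢 a-least b-least , c-g≤c-u 𝒢 closed a-least b-least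

c-u≤1 : ∀ 𝒢 {J b} → UnionMem 𝒢 J → c-u 𝒢 J b → b ≤ 1
c-u≤1 𝒢 J∈𝒢̄ (_ , b-least) = b-least 1 (HasGlobalInj-self J∈𝒢̄)

c-g-BoundedOnUnions : GraphClass → GraphClass → ℕ → Set
c-g-BoundedOnUnions 𝒢 ℋ C = ∀ J → UnionMem 𝒢 J → J ∈ ℋ → ∀ a → c-g 𝒢 J a → a ≤ C

bounded⇒c-g-boundedOnUnions : ∀ 𝒢 ℋ → Bounded ℋ (c-g 𝒢) (c-u 𝒢) → ∃ (c-g-BoundedOnUnions 𝒢 ℋ)
bounded⇒c-g-boundedOnUnions 𝒢 ℋ (f , bounded) = f 0 + f 1 , λ J J∈𝒢̄ J∈ℋ a a-least →
  decidable-stable (a ≤? f 0 + f 1)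
    (¬¬-map (via-c-u J∈𝒢̄ J∈ℋ a-least) (¬¬-∃-least 1 (HasGlobalInj-self J∈𝒢̄)))
  where
  f≤f0+f1 : ∀ b → b ≤ 1 → f b ≤ f 0 + f 1
  f≤f0+f1 zero          _        = m≤m+n (f 0) (f 1)
  f≤f0+f1 (suc zero)    _        = m≤n+m (f 1) (f 0)
  f≤f0+f1 (suc (suc _)) (s≤s ())

  via-c-u : ∀ {J a} → UnionMem 𝒢 J → J ∈ ℋ → c-g 𝒢 J a →
    ∃ (IsLeast (HasGlobalInj (UnionMem 𝒢) J)) → a ≤ f 0 + f 1
  via-c-u {J} {a} J∈𝒢̄ J∈ℋ a-least (b , b-least) =
    ≤-trans (proj₂ (bounded J J∈ℋ a b a-least b-least)) (f≤f0+f1 b (c-u≤1 𝒢 J∈𝒢̄ b-least))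

c-g≤c-u*C : ∀ 𝒢 ℋ {C} → K₂ ∈ 𝒢 → Monotone ℋ → c-g-BoundedOnUnions 𝒢 ℋ C →
  ∀ H → H ∈ ℋ → ∀ {a b} → c-g 𝒢 H a → c-u 𝒢 H b → a ≤ b * C
c-g≤c-u*C 𝒢 ℋ {C} K₂∈𝒢 mono bound H H∈ℋ {a} (_ , a-least) ((c , refl , inj) , _) =
  decidable-stable (a ≤? t c * C) (¬¬-map via-refinement (¬¬-∀-Fin guest-bounded))
  where
  guest-bounded : ∀ i → ¬ ¬ HasGlobalInj≤ (Mem 𝒢) (guest c i) C
  guest-bounded i = least≤⇒¬¬∃≤ (edge-cover K₂∈𝒢)
    (bound (guest c i) (inP c i) (mono H (guest c i) H∈ℋ (φ c i , inj i , hom c i)))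

  via-refinement : (∀ i → HasGlobalInj≤ (Mem 𝒢) (guest c i) C) → a ≤ t c * C
  via-refinement guest-covers =
    let (k , k≤tC , cover) = refine-cover c inj guest-covers in ≤-trans (a-least k cover) k≤tC

c-g-boundedOnUnions⇒bounded : ∀ 𝒢 ℋ → K₂ ∈ 𝒢 → Monotone ℋ →
  ∃ (c-g-BoundedOnUnions 𝒢 ℋ) → Bounded ℋ (c-g 𝒢) (c-u 𝒢)
c-g-boundedOnUnions⇒bounded 𝒢 ℋ K₂∈𝒢 mono (C , bound) = (_* C) , λ H H∈ℋ _ _ a-least b-least →
  c-u≤c-g 𝒢 a-least b-least , c-g≤c-u*C 𝒢 ℋ K₂∈𝒢 mono bound H H∈ℋ a-least b-least

theorem2 : (𝒢 ℋ : GraphClass) → K₂ ∈ 𝒢 →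
    (UnionClosed 𝒢 →
      (∀ H → H ∈ ℋ → ∀ a b → c-g 𝒢 H a → c-u 𝒢 H b → a ≡ b)
      × Bounded ℋ (c-g 𝒢) (c-u 𝒢))
    × (Monotone ℋ →
      (Bounded ℋ (c-g 𝒢) (c-u 𝒢)
        ⇔ Σ ℕ (λ C → ∀ J → UnionMem 𝒢 J → J ∈ ℋ → ∀ a → c-g 𝒢 J a → a ≤ C)))
theorem2 𝒢 ℋ K₂∈𝒢 =
  (λ closed → (λ _ _ _ _ → c-g≡c-u 𝒢 closed) , union-closed⇒bounded 𝒢 ℋ closed) ,
  (λ mono → mk⇔ (bounded⇒c-g-boundedOnUnions 𝒢 ℋ) (c-g-boundedOnUnions⇒bounded 𝒢 ℋ K₂∈𝒢 mono))
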